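{- Let $(T,r)$ be a rooted binary tree in which $r$ has two children $r_1,r_2$, and for $i=1,2$ let $T_{r_i}$ be the subtree induced by $r_i$ and its descendants, rooted at $r_i$. Among all such rooted binary trees with prescribed values of $|V(T_{r_1})|$ and $|V(T_{r_2})|$, the quantity $\sigma_T(r)=\sum_{u\in V(T)} d_T(u,r)$ is maximized when each $T_{r_i}$ ($i=1,2$) is a rooted binary caterpillar rooted at $r_i$.
   Context: A rooted binary tree is a tree $T$ with a designated vertex $r$ (the root) such that either $T$ consists of $r$ alone, or $r$ has degree $2$ and every other vertex has degree $1$ or $3$. A binary caterpillar is a tree in which every non-leaf vertex has degree $3$ and the non-leaf vertices induce a path. A rooted binary caterpillar is a rooted binary tree which is either a single vertex, or in which the vertices of degree at least $2$ induce a path having the root as an end vertex. $d_T$ denotes distance in $T$. -}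

module Defs where

open import Data.Nat using (ℕ; zero; suc; _+_)
open import Data.List using (List; []; _∷_; _++_; map)
open import Data.Nat.ListAction using (sum)

-- Rooted binary trees (up to isomorphism): either the root alone, or a root
-- with exactly two children, each the root of a rooted binary subtree.
data BTree : Set where
  leaf : BTree
  node : BTree → BTree → BTree

size : BTree → ℕ
size leaf = 1
size (node l r) = suc (size l + size r)

rootDistances : BTree → List ℕ
rootDistances leaf = 0 ∷ []
rootDistances (node l r) = 0 ∷ map suc (rootDistances l ++ rootDistances r)

σroot : BTree → ℕ
σroot t = sum (rootDistances t)

-- Rooted binary caterpillar: a single vertex, or the internal vertices
-- (degree ≥ 2) induce a path starting at the root, i.e. at each internal
-- vertex at most one child is internal (the other is a leaf).
data IsRootedCaterpillar : BTree → Set where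
  cat-leaf  : IsRootedCaterpillar leaf
  cat-left  : ∀ {t} → IsRootedCaterpillar t → IsRootedCaterpillar (node t leaf)
  cat-right : ∀ {t} → IsRootedCaterpillar t → IsRootedCaterpillar (node leaf t)

-- Idea: a rooted binary tree with n internal vertices has 2n + 1 vertices, and
-- σ(node l r) = (|l| + |r|) + σ l + σ r.  By induction σ t ≤ n (n + 1): the
-- only slack at a node with a and b internal vertices below it is the
-- cross term 2ab, which vanishes when one child is a leaf, as in
-- caterpillars.  So the caterpillar maximises σ among subtrees of given size,
-- and the two subtrees of the root contribute independently.
module Submission where

open import Defs
open import Data.Nat using (ℕ; suc; _+_; _*_; _≤_; z≤n)
open import Data.Nat.Properties
  using (+-mono-≤; +-monoʳ-≤; m≤m+n; suc-injective; *-cancelˡ-≡; module ≤-Reasoning)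
open import Data.List using ([]; _∷_; _++_; map; length)
open import Data.List.Properties using (length-map; length-++)
open import Data.Nat.ListAction using (sum)
open import Data.Nat.ListAction.Properties using (sum-++)
open import Data.Nat.Tactic.RingSolver using (solve-∀)
open import Relation.Binary.PropositionalEquality
  using (_≡_; refl; sym; trans; cong; cong₂; module ≡-Reasoning)

internal : BTree → ℕ
internal leaf = 0
internal (node l r) = suc (internal l + internal r)

size≡1+2*internal : ∀ t → size t ≡ suc (2 * internal t)
size≡1+2*internal leaf = refl
size≡1+2*internal (node l r) =
  cong suc (trans (cong₂ _+_ (size≡1+2*internal l) (size≡1+2*internal r))
                  (identity (internal l) (internal r)))
  where
  identity : ∀ a b → suc (2 * a) + suc (2 * b) ≡ 2 * suc (a + b)
  identity = solve-∀

internal-injective : ∀ {s t} → size s ≡ size t → internal s ≡ internal t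
internal-injective {s} {t} eq = *-cancelˡ-≡ (internal s) (internal t) 2
  (suc-injective (trans (sym (size≡1+2*internal s)) (trans eq (size≡1+2*internal t))))

length-rootDistances : ∀ t → length (rootDistances t) ≡ size t
length-rootDistances leaf = refl
length-rootDistances (node l r) = cong suc (begin
    length (map suc (rootDistances l ++ rootDistances r))
  ≡⟨ length-map suc (rootDistances l ++ rootDistances r) ⟩
    length (rootDistances l ++ rootDistances r)
  ≡⟨ length-++ (rootDistances l) ⟩
    length (rootDistances l) + length (rootDistances r)
  ≡⟨ cong₂ _+_ (length-rootDistances l) (length-rootDistances r) ⟩
    size l + size r ∎)
  where open ≡-Reasoning

sum-map-suc : ∀ xs → sum (map suc xs) ≡ length xs + sum xs
sum-map-suc [] = refl
sum-map-suc (x ∷ xs) = trans (cong (suc x +_) (sum-map-suc xs))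
  (identity x (length xs) (sum xs))
  where
  identity : ∀ x n s → suc x + (n + s) ≡ suc n + (x + s)
  identity = solve-∀

σroot-node : ∀ l r → σroot (node l r) ≡ (size l + size r) + (σroot l + σroot r)
σroot-node l r = begin
    sum (map suc (ds l ++ ds r))
  ≡⟨ sum-map-suc (ds l ++ ds r) ⟩
    length (ds l ++ ds r) + sum (ds l ++ ds r)
  ≡⟨ cong₂ _+_ (length-++ (ds l)) (sum-++ (ds l) (ds r)) ⟩
    (length (ds l) + length (ds r)) + (σroot l + σroot r)
  ≡⟨ cong (_+ (σroot l + σroot r)) (cong₂ _+_ (length-rootDistances l) (length-rootDistances r)) ⟩
    (size l + size r) + (σroot l + σroot r) ∎
  where
  open ≡-Reasoning
  ds = rootDistances

σroot-node-internal : ∀ l r →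
  σroot (node l r) ≡ 2 * suc (internal l + internal r) + (σroot l + σroot r)
σroot-node-internal l r = begin
    σroot (node l r)
  ≡⟨ σroot-node l r ⟩
    (size l + size r) + (σroot l + σroot r)
  ≡⟨ cong (_+ (σroot l + σroot r)) (suc-injective (size≡1+2*internal (node l r))) ⟩
    2 * suc (internal l + internal r) + (σroot l + σroot r) ∎
  where open ≡-Reasoning

σroot≤internal*suc : ∀ t → σroot t ≤ internal t * suc (internal t)
σroot≤internal*suc leaf = z≤n
σroot≤internal*suc (node l r) = begin
    σroot (node l r)
  ≡⟨ σroot-node-internal l r ⟩
    2 * suc (a + b) + (σroot l + σroot r)
  ≤⟨ +-monoʳ-≤ (2 * suc (a + b)) (+-mono-≤ (σroot≤internal*suc l) (σroot≤internal*suc r)) ⟩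
    2 * suc (a + b) + (a * suc a + b * suc b)
  ≤⟨ m≤m+n _ (2 * (a * b)) ⟩
    2 * suc (a + b) + (a * suc a + b * suc b) + 2 * (a * b)
  ≡⟨ identity a b ⟩
    suc (a + b) * suc (suc (a + b)) ∎
  where
  open ≤-Reasoning
  a = internal l
  b = internal r
  identity : ∀ a b → 2 * suc (a + b) + (a * suc a + b * suc b) + 2 * (a * b)
                     ≡ suc (a + b) * suc (suc (a + b))
  identity = solve-∀

σroot-caterpillar : ∀ {t} → IsRootedCaterpillar t → σroot t ≡ internal t * suc (internal t)
σroot-caterpillar cat-leaf = refl
σroot-caterpillar (cat-left {t} c) = begin
    σroot (node t leaf)
  ≡⟨ σroot-node-internal t leaf ⟩
    2 * suc (internal t + 0) + (σroot t + 0)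
  ≡⟨ cong (λ s → 2 * suc (internal t + 0) + (s + 0)) (σroot-caterpillar c) ⟩
    2 * suc (internal t + 0) + (internal t * suc (internal t) + 0)
  ≡⟨ identity (internal t) ⟩
    suc (internal t + 0) * suc (suc (internal t + 0)) ∎
  where
  open ≡-Reasoning
  identity : ∀ a → 2 * suc (a + 0) + (a * suc a + 0) ≡ suc (a + 0) * suc (suc (a + 0))
  identity = solve-∀
σroot-caterpillar (cat-right {t} c) = begin
    σroot (node leaf t)
  ≡⟨ σroot-node-internal leaf t ⟩
    2 * suc (internal t) + σroot t
  ≡⟨ cong (2 * suc (internal t) +_) (σroot-caterpillar c) ⟩
    2 * suc (internal t) + internal t * suc (internal t)
  ≡⟨ identity (internal t) ⟩
    suc (internal t) * suc (suc (internal t)) ∎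
  where
  open ≡-Reasoning
  identity : ∀ a → 2 * suc a + a * suc a ≡ suc a * suc (suc a)
  identity = solve-∀

σroot≤σroot-caterpillar : ∀ {T C} → IsRootedCaterpillar C → size C ≡ size T → σroot T ≤ σroot C
σroot≤σroot-caterpillar {T} {C} c eq = begin
    σroot T
  ≤⟨ σroot≤internal*suc T ⟩
    internal T * suc (internal T)
  ≡⟨ cong (λ n → n * suc n) (internal-injective (sym eq)) ⟩
    internal C * suc (internal C)
  ≡⟨ sym (σroot-caterpillar c) ⟩
    σroot C ∎
  where open ≤-Reasoning

proposition2p5 : (T₁ T₂ C₁ C₂ : BTree)
    → IsRootedCaterpillar C₁ → IsRootedCaterpillar C₂
    → size C₁ ≡ size T₁ → size C₂ ≡ size T₂
    → σroot (node T₁ T₂) ≤ σroot (node C₁ C₂)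
proposition2p5 T₁ T₂ C₁ C₂ c₁ c₂ e₁ e₂ = begin
    σroot (node T₁ T₂)
  ≡⟨ σroot-node T₁ T₂ ⟩
    (size T₁ + size T₂) + (σroot T₁ + σroot T₂)
  ≤⟨ +-monoʳ-≤ (size T₁ + size T₂)
       (+-mono-≤ (σroot≤σroot-caterpillar c₁ e₁) (σroot≤σroot-caterpillar c₂ e₂)) ⟩
    (size T₁ + size T₂) + (σroot C₁ + σroot C₂)
  ≡⟨ cong (_+ (σroot C₁ + σroot C₂)) (sym (cong₂ _+_ e₁ e₂)) ⟩
    (size C₁ + size C₂) + (σroot C₁ + σroot C₂)
  ≡⟨ sym (σroot-node C₁ C₂) ⟩
    σroot (node C₁ C₂) ∎
  where open ≤-Reasoning
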